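{- Let $\mathcal{F} \subset \mathcal{P}([n])$ be an $r$-closed $\theta$-intersecting family, where $r \geq 3$ and $\theta \in (0,1)$, and let $i$ be such that $|\mathcal{F}(i)| \geq 2$. Then $\mathrm{Tor}(A) \neq \emptyset$ for all $A \in \mathcal{F}(i)$.
   Context: A family $\mathcal{F} \subset \mathcal{P}([n])$ is $r$-closed $\theta$-intersecting if for each $2 \leq t \leq r$ and any $t$ distinct sets $A_1,\dots,A_t \in \mathcal{F}$ we have $|A_1 \cap \dots \cap A_t| \in \{\theta|A_1|, \dots, \theta|A_t|\}$. $\mathcal{F}(i) := \mathcal{F} \cap \binom{[n]}{i}$ is the collection of $i$-element sets of $\mathcal{F}$. For $A \in \mathcal{F}$, $\mathrm{Tor}(A) := \{B \in \mathcal{F} : |B| \geq |A|,\ |A \cap B| = \theta|A|\}$.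
   Formalization: The parameter θ ranges over the rationals in (0,1). -}

module Defs where

open import Data.Nat using (ℕ; _≤_)
open import Data.Integer using (+_)
open import Data.Rational using (ℚ; _/_; _*_)
open import Data.Fin using (Fin)
open import Data.Fin.Subset using (Subset; ⋂; _∩_; ∣_∣)
open import Data.Vec.Functional using (toList)
open import Data.Product using (∃; Σ; _×_)
open import Function.Definitions using (Injective)
open import Relation.Binary.PropositionalEquality using (_≡_)

ℕ→ℚ : ℕ → ℚ
ℕ→ℚ k = (+ k) / 1

Family : ℕ → Set₁
Family n = Subset n → Set

⋂ᶠ : ∀ {n t} → (Fin t → Subset n) → Subset n
⋂ᶠ As = ⋂ (toList As)

RClosedθIntersecting : ∀ {n} → ℕ → ℚ → Family n → Set
RClosedθIntersecting {n} r θ F =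
  ∀ (t : ℕ) → 2 ≤ t → t ≤ r →
  (As : Fin t → Subset n) → Injective _≡_ _≡_ As → (∀ j → F (As j)) →
  ∃ λ (j : Fin t) → ℕ→ℚ ∣ ⋂ᶠ As ∣ ≡ θ * ℕ→ℚ ∣ As j ∣

_⟨_⟩ : ∀ {n} → Family n → ℕ → Family n
(F ⟨ i ⟩) A = F A × ∣ A ∣ ≡ i

Tor : ∀ {n} → Family n → ℚ → Subset n → Family n
Tor F θ A B = F B × (∣ A ∣ ≤ ∣ B ∣) × (ℕ→ℚ ∣ A ∩ B ∣ ≡ θ * ℕ→ℚ ∣ A ∣)

{-# OPTIONS --safe #-}
module Submission where

-- Two distinct sets A, B ∈ F(i) form a 2-set subfamily, so 2-closedness
-- (available since r ≥ 2) gives |A ∩ B| ∈ {θ|A|, θ|B|} = {θ|A|}; with |B| = |A|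
-- this puts B in Tor(A). Every A ∈ F(i) differs from one of the two given members
-- of F(i).

open import Defs
open import Data.Nat using (ℕ; _≤_; s≤s; z≤n)
open import Data.Nat.Properties using (≤-refl; ≤-reflexive; ≤-trans)
open import Data.Rational using (ℚ; 0ℚ; 1ℚ; _<_; _*_)
open import Data.Bool using () renaming (_≟_ to _≟ᴮ_)
open import Data.Fin using (Fin; zero; suc)
open import Data.Fin.Subset using (Subset; _∩_; ∣_∣)
open import Data.Fin.Subset.Properties using (∩-identityʳ)
open import Data.Vec.Functional using ([]; _∷_)
open import Data.Vec.Properties using (≡-dec)
open import Data.Product using (∃; _×_; _,_)
open import Data.Sum using (_⊎_; inj₁; inj₂; [_,_])
open import Data.Empty using (⊥-elim)
open import Function.Definitions using (Injective)
open import Relation.Nullary using (yes; no)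
open import Relation.Binary.PropositionalEquality
  using (_≡_; _≢_; refl; sym; trans; cong; subst)

⋂ᶠ-pair : ∀ {n} (A B : Subset n) → ⋂ᶠ (A ∷ B ∷ []) ≡ A ∩ B
⋂ᶠ-pair A B = cong (A ∩_) (∩-identityʳ B)

pair-injective : ∀ {n} {A B : Subset n} → A ≢ B → Injective _≡_ _≡_ (A ∷ B ∷ [])
pair-injective A≢B {zero}     {zero}     _   = refl
pair-injective A≢B {zero}     {suc zero} A≡B = ⊥-elim (A≢B A≡B)
pair-injective A≢B {suc zero} {zero}     B≡A = ⊥-elim (A≢B (sym B≡A))
pair-injective A≢B {suc zero} {suc zero} _   = refl

∣∩∣-of-distinct-pair : ∀ {n r} θ {F : Family n} → 2 ≤ r → RClosedθIntersecting r θ F →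
  ∀ {A B} → A ≢ B → F A → F B →
  ℕ→ℚ ∣ A ∩ B ∣ ≡ θ * ℕ→ℚ ∣ A ∣ ⊎ ℕ→ℚ ∣ A ∩ B ∣ ≡ θ * ℕ→ℚ ∣ B ∣
∣∩∣-of-distinct-pair θ {F} 2≤r closed {A} {B} A≢B FA FB
  with closed 2 ≤-refl 2≤r (A ∷ B ∷ []) (pair-injective A≢B) members
  where
  members : ∀ j → F ((A ∷ B ∷ []) j)
  members zero       = FA
  members (suc zero) = FB
... | zero     , eq = inj₁ (subst (λ C → ℕ→ℚ ∣ C ∣ ≡ _) (⋂ᶠ-pair A B) eq)
... | suc zero , eq = inj₂ (subst (λ C → ℕ→ℚ ∣ C ∣ ≡ _) (⋂ᶠ-pair A B) eq)

distinct-equal-size-∈-Tor : ∀ {n r} θ {F : Family n} → 2 ≤ r → RClosedθIntersecting r θ F →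
  ∀ {A B} → A ≢ B → F A → F B → ∣ A ∣ ≡ ∣ B ∣ → Tor F θ A B
distinct-equal-size-∈-Tor θ 2≤r closed {A} {B} A≢B FA FB |A|≡|B| =
  FB , ≤-reflexive |A|≡|B| ,
  [ (λ eq → eq) , (λ eq → subst (λ k → ℕ→ℚ ∣ A ∩ B ∣ ≡ θ * ℕ→ℚ k) (sym |A|≡|B|) eq) ]
    (∣∩∣-of-distinct-pair θ 2≤r closed A≢B FA FB)

differs-from-one-of : ∀ {n} {A₁ A₂ : Subset n} → A₁ ≢ A₂ →
  (A : Subset n) → A ≢ A₁ ⊎ A ≢ A₂
differs-from-one-of A₁≢A₂ A with ≡-dec _≟ᴮ_ A _
... | no  A≢A₁ = inj₁ A≢A₁
... | yes refl = inj₂ A₁≢A₂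

proposition2p5 : (n r : ℕ) (θ : ℚ) (F : Family n) →
    3 ≤ r → 0ℚ < θ → θ < 1ℚ →
    RClosedθIntersecting r θ F →
    (i : ℕ) →
    (∃ λ (A₁ : Subset n) → ∃ λ (A₂ : Subset n) → A₁ ≢ A₂ × (F ⟨ i ⟩) A₁ × (F ⟨ i ⟩) A₂) →
    (A : Subset n) → (F ⟨ i ⟩) A → ∃ λ (B : Subset n) → Tor F θ A B
proposition2p5 n r θ F 3≤r _ _ closed i (A₁ , A₂ , A₁≢A₂ , (FA₁ , ∣A₁∣≡i) , (FA₂ , ∣A₂∣≡i)) A (FA , ∣A∣≡i) =
  [ (λ A≢A₁ → A₁ , distinct-equal-size-∈-Tor θ 2≤r closed A≢A₁ FA FA₁ (same-size ∣A₁∣≡i))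
  , (λ A≢A₂ → A₂ , distinct-equal-size-∈-Tor θ 2≤r closed A≢A₂ FA FA₂ (same-size ∣A₂∣≡i))
  ] (differs-from-one-of A₁≢A₂ A)
  where
  2≤r : 2 ≤ r
  2≤r = ≤-trans (s≤s (s≤s z≤n)) 3≤r
  same-size : ∀ {k} → k ≡ i → ∣ A ∣ ≡ k
  same-size k≡i = trans ∣A∣≡i (sym k≡i)
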